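{- Let $s$ be a binary string with $a$ 0's and $b$ 1's, and let $t$ be any binary string. Then \[P_{s\circ t}(x,y)=P_s(x,y)\,P_t\!\left(x^{a+1}y^b,\;x^ay^{b+1}\right).\]
   Context: For a binary string $u=u_1\cdots u_n$, let $a_i,b_i$ be the numbers of 0's and 1's among $u_1,\dots,u_i$; the generating polynomial is $P_u(x,y)=\sum_{i=0}^n x^{a_i}y^{b_i}$. The interleaving of $s$ with $t=t_1\cdots t_m$ is $s\circ t=s\,t_1\,s\,t_2\,s\cdots t_m\,s$. -}

module Defs where

open import Level using (Level)
open import Data.Bool using (Bool; true; false)
open import Data.List using (List; []; _∷_; _++_)
open import Data.Nat using (ℕ; zero; suc)
open import Algebra.Bundles using (CommutativeRing)

-- Binary strings: false = the letter 0, true = the letter 1.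
BinStr : Set
BinStr = List Bool

zeros : BinStr → ℕ
zeros [] = 0
zeros (false ∷ u) = suc (zeros u)
zeros (true ∷ u) = zeros u

ones : BinStr → ℕ
ones [] = 0
ones (false ∷ u) = ones u
ones (true ∷ u) = suc (ones u)

-- interleaving  s ∘ t = s t₁ s t₂ s ⋯ t_m s
interleave : BinStr → BinStr → BinStr
interleave s [] = s
interleave s (c ∷ t) = s ++ (c ∷ interleave s t)

module _ {c ℓ : Level} (R : CommutativeRing c ℓ) where
  open CommutativeRing R

  pow : Carrier → ℕ → Carrier
  pow x zero = 1#
  pow x (suc n) = x * pow x n

  -- generating polynomial evaluated at (x , y):
  --   P_u(x,y) = Σ_{i=0}^{n} x^{a_i} y^{b_i}
  -- defined by recursion on u: the prefix of length 0 contributes 1,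
  -- and reading a letter multiplies the remaining prefixes by x (for 0) or y (for 1).
  P : BinStr → Carrier → Carrier → Carrier
  P [] x y = 1#
  P (false ∷ u) x y = 1# + x * P u x y
  P (true ∷ u) x y = 1# + y * P u x y

module Submission where

open import Defs
open import Level using (Level)
open import Data.Nat using (zero; suc)
import Data.Nat as ℕ
open import Data.Bool using (Bool; true; false)
open import Data.List using ([]; _∷_; _++_)
open import Algebra.Bundles using (CommutativeRing)
import Algebra.Solver.Ring.NaturalCoefficients.Default as Solver
import Relation.Binary.Reasoning.Setoid as SetoidReasoning

-- Write M_u = x^{a(u)} y^{b(u)} for the monomial of a whole string u and
-- z_c ∈ {x, y} for the variable of a letter c. Splitting u = v c w gives
--   P_u = P_v + M_v z_c P_w,
-- so with u = s ∘ (c t) = s c (s ∘ t) and induction on t,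
--   P_{s∘(c t)} = P_s (1 + M_s z_c P_t(X, Y)),
-- where M_s z_c is X = x^{a+1} y^b for c = 0 and Y = x^a y^{b+1} for c = 1.
-- The right-hand side is P_s · P_{c t}(X, Y).

module _ {c ℓ : Level} (R : CommutativeRing c ℓ) where
  open CommutativeRing R
  open Solver commutativeSemiring
  open SetoidReasoning setoid

  letter : Carrier → Carrier → Bool → Carrier
  letter x y false = x
  letter x y true = y

  monomial : Carrier → Carrier → BinStr → Carrier
  monomial x y u = pow R x (zeros u) * pow R y (ones u)

  P-∷ : ∀ b w x y → P R (b ∷ w) x y ≈ 1# + letter x y b * P R w x y
  P-∷ false w x y = refl
  P-∷ true w x y = refl

  pow-+1 : ∀ v n → pow R v (n ℕ.+ 1) ≈ pow R v n * v
  pow-+1 v zero = trans (*-identityʳ v) (sym (*-identityˡ v))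
  pow-+1 v (suc n) = trans (*-congˡ (pow-+1 v n)) (sym (*-assoc v (pow R v n) v))

  monomial-∷ : ∀ b u x y → monomial x y (b ∷ u) ≈ letter x y b * monomial x y u
  monomial-∷ false u x y = *-assoc x (pow R x (zeros u)) (pow R y (ones u))
  monomial-∷ true u x y =
    solve 3 (λ X Y Z → X :* (Y :* Z) := Y :* (X :* Z)) refl
      (pow R x (zeros u)) y (pow R y (ones u))

  monomial-*-letter : ∀ u b x y →
    monomial x y u * letter x y b ≈
    letter (pow R x (zeros u ℕ.+ 1) * pow R y (ones u))
           (pow R x (zeros u) * pow R y (ones u ℕ.+ 1)) b
  monomial-*-letter u false x y = begin
      pow R x (zeros u) * pow R y (ones u) * x
    ≈⟨ solve 3 (λ X Y Z → X :* Y :* Z := X :* Z :* Y) refl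
         (pow R x (zeros u)) (pow R y (ones u)) x ⟩
      pow R x (zeros u) * x * pow R y (ones u)
    ≈⟨ *-congʳ (sym (pow-+1 x (zeros u))) ⟩
      pow R x (zeros u ℕ.+ 1) * pow R y (ones u) ∎
  monomial-*-letter u true x y =
    trans (*-assoc (pow R x (zeros u)) (pow R y (ones u)) y)
          (*-congˡ (sym (pow-+1 y (ones u))))

  P-++-∷ : ∀ u b w x y →
    P R (u ++ b ∷ w) x y ≈ P R u x y + monomial x y u * (letter x y b * P R w x y)
  P-++-∷ [] b w x y =
    trans (P-∷ b w x y) (+-congˡ (sym (trans (*-congʳ (*-identityˡ 1#)) (*-identityˡ _))))
  P-++-∷ (a ∷ u) b w x y = begin
      P R (a ∷ u ++ b ∷ w) x y
    ≈⟨ P-∷ a (u ++ b ∷ w) x y ⟩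
      1# + z * P R (u ++ b ∷ w) x y
    ≈⟨ +-congˡ (*-congˡ (P-++-∷ u b w x y)) ⟩
      1# + z * (P R u x y + monomial x y u * rest)
    ≈⟨ solve 4 (λ Z Pu Mu W → con 1 :+ Z :* (Pu :+ Mu :* W)
                  := (con 1 :+ Z :* Pu) :+ Z :* Mu :* W) refl
         z (P R u x y) (monomial x y u) rest ⟩
      (1# + z * P R u x y) + z * monomial x y u * rest
    ≈⟨ +-cong (sym (P-∷ a u x y)) (*-congʳ (sym (monomial-∷ a u x y))) ⟩
      P R (a ∷ u) x y + monomial x y (a ∷ u) * rest ∎
    where
      z = letter x y a
      rest = letter x y b * P R w x y

lemma12 : {c ℓ : Level} (R : CommutativeRing c ℓ) (s t : BinStr)
          (x y : CommutativeRing.Carrier R) →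
          CommutativeRing._≈_ R
            (P R (interleave s t) x y)
            (CommutativeRing._*_ R (P R s x y)
               (P R t (CommutativeRing._*_ R (pow R x (zeros s ℕ.+ 1)) (pow R y (ones s)))
                      (CommutativeRing._*_ R (pow R x (zeros s)) (pow R y (ones s ℕ.+ 1)))))
lemma12 R s [] x y = CommutativeRing.sym R (CommutativeRing.*-identityʳ R _)
lemma12 R s (b ∷ t) x y = begin
    P R (s ++ b ∷ interleave s t) x y
  ≈⟨ P-++-∷ R s b (interleave s t) x y ⟩
    Ps + Ms * (z * P R (interleave s t) x y)
  ≈⟨ +-congˡ (*-congˡ (*-congˡ (lemma12 R s t x y))) ⟩
    Ps + Ms * (z * (Ps * Q))
  ≈⟨ solve 4 (λ Ps Ms Z Q → Ps :+ Ms :* (Z :* (Ps :* Q))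
                := Ps :* (con 1 :+ Ms :* Z :* Q)) refl Ps Ms z Q ⟩
    Ps * (1# + Ms * z * Q)
  ≈⟨ *-congˡ (+-congˡ (*-congʳ (monomial-*-letter R s b x y))) ⟩
    Ps * (1# + letter R X Y b * Q)
  ≈⟨ *-congˡ (sym (P-∷ R b t X Y)) ⟩
    Ps * P R (b ∷ t) X Y ∎
  where
    open CommutativeRing R
    open Solver commutativeSemiring
    open SetoidReasoning setoid
    X = pow R x (zeros s ℕ.+ 1) * pow R y (ones s)
    Y = pow R x (zeros s) * pow R y (ones s ℕ.+ 1)
    Ps = P R s x y
    Ms = monomial R x y s
    z = letter R x y b
    Q = P R t X Y
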